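{- Let $d$ be a positive integer and let $G$ be a finite simple graph with maximum degree $\Delta(G)\le 2^{d+1}-1$. Then $G$ can be located on $2^{d}$ columns in $\mathbb{Z}^{d+1}$.
   Context: A column of $\mathbb{Z}^m$ ($m\ge2$) with rank $(x_1,\dots,x_{m-1})\in\mathbb{Z}^{m-1}$ is $\{(x_1,\dots,x_{m-1},x):x\in\mathbb{Z}\}$. A grid drawing of $G=(V,E)$ in $\mathbb{Z}^m$ is an injective map $\phi\colon V\to\mathbb{Z}^m$ such that for every edge $uv$ and vertex $w$, if $\phi(w)$ lies on the closed segment $\overline{\phi(u)\phi(v)}$ then $w\in\{u,v\}$; it is primitive if each such edge segment contains no grid points other than its endpoints. $G$ can be located on $l$ columns in $\mathbb{Z}^m$ if it has a primitive grid drawing in $\mathbb{Z}^m$ whose vertex images lie in the union of $l$ columns. -}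

module Defs where

open import Data.Nat using (ℕ; zero; suc; _≤_; _<_)
open import Data.Integer using (ℤ; +_; _-_; _*_)
open import Data.Bool using (Bool; true; false)
open import Data.Fin using (Fin)
open import Data.Vec using (Vec; lookup; init; allFin; count)
open import Data.Product using (Σ; _×_; ∃)
open import Data.Sum using (_⊎_)
open import Relation.Binary.PropositionalEquality using (_≡_)
open import Relation.Nullary using (Dec)
open import Data.Bool using (T)

record Graph (n : ℕ) : Set where
  field
    adj   : Fin n → Fin n → Bool
    sym   : ∀ u v → adj u v ≡ adj v u
    irrefl : ∀ v → adj v v ≡ false

open Graph public

degree : ∀ {n} → Graph n → Fin n → ℕ
degree {n} G v = count (λ w → Data.Bool._≟_ (adj G v w) true) (allFin n)

Point : ℕ → Set
Point m = Vec ℤ m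

-- p lies on the closed segment [a,b]: p = a + (s/t)(b - a) with 0 ≤ s/t ≤ 1,
-- written with integers as t (p - a) = s (b - a), 0 ≤ s ≤ t, t > 0.
OnSegment : ∀ {m} → Point m → Point m → Point m → Set
OnSegment {m} a b p =
  Σ ℕ λ s → Σ ℕ λ t → (0 < t) × (s ≤ t) ×
    (∀ (i : Fin m) → (+ t) * (lookup p i - lookup a i) ≡ (+ s) * (lookup b i - lookup a i))

IsGridDrawing : ∀ {n m} → Graph n → (Fin n → Point m) → Set
IsGridDrawing {n} G φ =
  (∀ u v → φ u ≡ φ v → u ≡ v) ×
  (∀ u v w → adj G u v ≡ true → OnSegment (φ u) (φ v) (φ w) → (w ≡ u) ⊎ (w ≡ v))

IsPrimitiveGridDrawing : ∀ {n m} → Graph n → (Fin n → Point m) → Set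
IsPrimitiveGridDrawing {n} {m} G φ =
  IsGridDrawing G φ ×
  (∀ u v (p : Point m) → adj G u v ≡ true → OnSegment (φ u) (φ v) p →
     (p ≡ φ u) ⊎ (p ≡ φ v))

-- The column of rank r ∈ Z^k in Z^(k+1) is {(r, x) : x ∈ Z}; a point q lies in
-- it iff init q ≡ r.
LocatedOnColumns : ∀ {n} → Graph n → (l k : ℕ) → Set
LocatedOnColumns {n} G l k =
  Σ (Fin n → Point (suc k)) λ φ →
    IsPrimitiveGridDrawing G φ ×
    Σ (Fin l → Vec ℤ k) λ rank →
      (∀ i j → rank i ≡ rank j → i ≡ j) ×
      (∀ v → ∃ λ (j : Fin l) → init (φ v) ≡ rank j)

module Submission where

-- With k colours and maximum degree at most 2k − 1 there is a colouring in which every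
-- vertex has at most one neighbour of its own colour: as long as some vertex has two
-- such neighbours, one of the k colours occurs at most once in its neighbourhood, and
-- recolouring the vertex with it strictly decreases the number of monochromatic edges.
-- Take k = 2^d and give colour i the column whose rank is the binary expansion of i.
-- Each colour class induces a matching, so heights can be chosen injectively with the
-- two ends of every monochromatic edge at consecutive heights. Then every edge changes
-- some coordinate by exactly 1, which forces its segment to contain no lattice point
-- other than its endpoints.

open import Defs hiding (sym; irrefl)
open import Data.Nat using (ℕ; _≤_; _^_; _∸_; _+_)

open import Data.Bool as Bool using (true)
open import Data.Fin as Fin
  using (Fin; zero; suc; toℕ; _≟_; punchIn; punchOut; inject₁; fromℕ; fromℕ<; quotient; remainder; combine; remQuot)
open import Data.Fin.Properties as FinP
  using (any?; all?; ¬∀⟶∃¬; toℕ-injective; punchInᵢ≢i; punchIn-punchOut; combine-remQuot)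
open import Data.Integer as ℤ using (ℤ; _-_; ∣_∣)
import Data.Integer.Properties as ℤP
open import Data.Nat using (zero; suc; _*_; _<_; _≤?_; z≤n; s≤s)
open import Data.Nat.Induction using (<-wellFounded)
open import Data.Nat.Properties hiding (_≟_; _<?_)
open import Data.Product using (Σ; ∃-syntax; _×_; _,_; uncurry)
open import Data.Sum using (_⊎_; inj₁; inj₂; [_,_]′)
open import Data.Vec using (Vec; []; _∷_; lookup; _∷ʳ_; count; tabulate)
open import Data.Vec.Functional using (updateAt)
open import Data.Vec.Functional.Properties using (updateAt-updates; updateAt-minimal)
open import Data.Vec.Properties using (init-∷ʳ; ∷ʳ-injectiveʳ; tabulate∘lookup; tabulate-cong)
open import Function using (_∘_; id; const)
open import Induction.WellFounded using (Acc; acc)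
open import Relation.Binary.Definitions using (Decidable; tri<; tri≈; tri>)
open import Relation.Binary.PropositionalEquality
  using (_≡_; _≢_; refl; sym; trans; cong; cong₂; subst; subst₂; module ≡-Reasoning)
open import Relation.Nullary using (Dec; yes; no; ¬_; contradiction)
open import Relation.Nullary.Decidable using (_×-dec_)
open import Relation.Unary as U using (Pred)

open import Algebra.Properties.AbelianGroup ℤP.+-0-abelianGroup using (∙-cancelʳ)
open import Algebra.Properties.Semiring.Sum +-*-semiring
  using (sum; sum-syntax; sum-cong-≗; ∑-distrib-+; ∑-comm; sum-remove; sum-replicate-zero; *-distribˡ-sum)

iverson : ∀ {p} {P : Set p} → Dec P → ℕ
iverson (yes _) = 1
iverson (no _)  = 0

iverson-yes : ∀ {p} {P : Set p} (P? : Dec P) → P → iverson P? ≡ 1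
iverson-yes (yes _) _ = refl
iverson-yes (no ¬p) p = contradiction p ¬p

iverson-no : ∀ {p} {P : Set p} (P? : Dec P) → ¬ P → iverson P? ≡ 0
iverson-no (yes p) ¬p = contradiction p ¬p
iverson-no (no _)  _  = refl

count-tabulate : ∀ {a p} {A : Set a} {P : Pred A p} (P? : U.Decidable P) {m} (f : Fin m → A) →
                 count P? (tabulate f) ≡ ∑[ i < m ] iverson (P? (f i))
count-tabulate P? {zero}  f = refl
count-tabulate P? {suc m} f with P? (f zero)
... | yes _ = cong suc (count-tabulate P? (f ∘ suc))
... | no _  = count-tabulate P? (f ∘ suc)

≤-sum : ∀ {n} (f : Fin n → ℕ) i → f i ≤ sum f
≤-sum {suc n} f i = ≤-trans (m≤m+n (f i) _) (≤-reflexive (sym (sum-remove {i = i} f)))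

+-≤-sum : ∀ {n} (f : Fin n → ℕ) {i j} → i ≢ j → f i + f j ≤ sum f
+-≤-sum {suc n} f {i} {j} i≢j = begin
  f i + f j                                       ≡⟨ cong (λ k → f i + f k) (punchIn-punchOut i≢j) ⟨
  f i + f (punchIn i (punchOut i≢j))              ≤⟨ +-monoʳ-≤ (f i) (≤-sum (f ∘ punchIn i) (punchOut i≢j)) ⟩
  f i + sum (f ∘ punchIn i)                       ≡⟨ sum-remove f ⟨
  sum f                                           ∎
  where open ≤-Reasoning

*-≤-sum : ∀ {n} m (f : Fin n → ℕ) → (∀ i → m ≤ f i) → n * m ≤ sum f
*-≤-sum {zero}  m f m≤f = z≤n
*-≤-sum {suc n} m f m≤f = +-mono-≤ (m≤f zero) (*-≤-sum m (f ∘ suc) (m≤f ∘ suc))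

sum-update : ∀ {n} (f g : Fin n → ℕ) i → (∀ j → j ≢ i → f j ≡ g j) → sum f + g i ≡ sum g + f i
sum-update {suc n} f g i f≡g = begin
  sum f + g i              ≡⟨ cong (_+ g i) (sum-remove f) ⟩
  f i + rest f + g i       ≡⟨ cong (λ s → f i + s + g i) rest≡ ⟩
  f i + rest g + g i       ≡⟨ swap (f i) (rest g) (g i) ⟩
  g i + rest g + f i       ≡⟨ cong (_+ f i) (sum-remove g) ⟨
  sum g + f i              ∎
  where
  open ≡-Reasoning
  rest : (Fin (suc n) → ℕ) → ℕ
  rest h = sum (h ∘ punchIn i)
  rest≡ : rest f ≡ rest g
  rest≡ = sum-cong-≗ (λ j → f≡g (punchIn i j) (punchInᵢ≢i i j))
  swap : ∀ a b c → a + b + c ≡ c + b + a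
  swap a b c = trans (+-comm (a + b) c) (trans (cong (c +_) (+-comm a b)) (sym (+-assoc c b a)))

sum-iverson-≟ : ∀ {n} (i : Fin n) → ∑[ j < n ] iverson (i ≟ j) ≡ 1
sum-iverson-≟ {suc n} i = begin
  ∑[ j < suc n ] iverson (i ≟ j)                                ≡⟨ sum-remove {i = i} (iverson ∘ (i ≟_)) ⟩
  iverson (i ≟ i) + ∑[ j < n ] iverson (i ≟ punchIn i j)        ≡⟨ cong₂ _+_ (iverson-yes (i ≟ i) refl) rest≡0 ⟩
  1                                                             ∎
  where
  open ≡-Reasoning
  rest≡0 : ∑[ j < n ] iverson (i ≟ punchIn i j) ≡ 0
  rest≡0 = trans (sum-cong-≗ (λ j → iverson-no (i ≟ punchIn i j) (punchInᵢ≢i i j ∘ sym))) (sum-replicate-zero n)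

-- Each side is the common part of M and M′ outside row and column x, plus row and column x
-- of both matrices.
sum²-update : ∀ {n} (M M′ : Fin n → Fin n → ℕ) x →
              (∀ v → M v x ≡ M x v) → (∀ v → M′ v x ≡ M′ x v) → M x x ≡ 0 → M′ x x ≡ 0 →
              (∀ v w → v ≢ x → w ≢ x → M v w ≡ M′ v w) →
              sum (sum ∘ M) + sum (M′ x) + sum (M′ x) ≡ sum (sum ∘ M′) + sum (M x) + sum (M x)
sum²-update {n} M M′ x M-sym M′-sym Mxx≡0 M′xx≡0 M≡M′ = begin
  sum (sum ∘ M) + sum (M′ x) + sum (M′ x)
    ≡⟨ cong₂ _+_ (sum-with M M′ M′-sym) (row-with M′ M Mxx≡0) ⟨
  sum H + H′ x
    ≡⟨ sum-update H H′ x (λ v v≢x → sum-update (M v) (M′ v) x (λ w → M≡M′ v w v≢x)) ⟩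
  sum H′ + H x
    ≡⟨ cong₂ _+_ (sum-with M′ M M-sym) (row-with M M′ M′xx≡0) ⟩
  sum (sum ∘ M′) + sum (M x) + sum (M x)
    ∎
  where
  open ≡-Reasoning
  with-column : (Fin n → Fin n → ℕ) → (Fin n → Fin n → ℕ) → Fin n → ℕ
  with-column A B v = sum (A v) + B v x
  H H′ : Fin n → ℕ
  H = with-column M M′
  H′ = with-column M′ M
  sum-with : ∀ A B → (∀ v → B v x ≡ B x v) → sum (with-column A B) ≡ sum (sum ∘ A) + sum (B x)
  sum-with A B B-sym = trans (∑-distrib-+ (sum ∘ A) (λ v → B v x)) (cong (sum (sum ∘ A) +_) (sum-cong-≗ B-sym))
  row-with : ∀ A B → B x x ≡ 0 → with-column A B x ≡ sum (A x)
  row-with A B Bxx≡0 = trans (cong (sum (A x) +_) Bxx≡0) (+-identityʳ _)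

module _ {n} (G : Graph n) where

  edge : Fin n → Fin n → ℕ
  edge v w = iverson (adj G v w Bool.≟ true)

  edge-sym : ∀ v w → edge v w ≡ edge w v
  edge-sym v w = cong (λ b → iverson (b Bool.≟ true)) (Graph.sym G v w)

  edge-irrefl : ∀ v → edge v v ≡ 0
  edge-irrefl v = cong (λ b → iverson (b Bool.≟ true)) (Graph.irrefl G v)

  degree≡sum-edge : ∀ v → degree G v ≡ sum (edge v)
  degree≡sum-edge v = count-tabulate (λ w → adj G v w Bool.≟ true) id

  Colouring : ℕ → Set
  Colouring k = Fin n → Fin k

  module _ {k : ℕ} where

    neighboursOfColour : Colouring k → Fin n → Fin k → ℕ
    neighboursOfColour c v j = ∑[ w < n ] (edge v w * iverson (c w ≟ j))

    monochromatic : Colouring k → Fin n → Fin n → ℕ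
    monochromatic c v w = edge v w * iverson (c w ≟ c v)

    defect : Colouring k → Fin n → ℕ
    defect c v = sum (monochromatic c v)

    totalDefect : Colouring k → ℕ
    totalDefect c = sum (defect c)

    OneDefective : Colouring k → Set
    OneDefective c = ∀ v → defect c v ≤ 1

    recolour : Colouring k → Fin n → Fin k → Colouring k
    recolour c x j = updateAt c x (const j)

    monochromatic-sym : ∀ c v w → monochromatic c v w ≡ monochromatic c w v
    monochromatic-sym c v w = cong₂ _*_ (edge-sym v w) (iverson-≟-sym (c w) (c v))
      where
      iverson-≟-sym : ∀ i j → iverson (i ≟ j) ≡ iverson (j ≟ i)
      iverson-≟-sym i j with i ≟ j
      ... | yes i≡j = sym (iverson-yes (j ≟ i) (sym i≡j))
      ... | no i≢j  = sym (iverson-no (j ≟ i) (i≢j ∘ sym))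

    monochromatic-irrefl : ∀ c v → monochromatic c v v ≡ 0
    monochromatic-irrefl c v = cong (_* iverson (c v ≟ c v)) (edge-irrefl v)

    sum-neighboursOfColour : ∀ c v → ∑[ j < k ] neighboursOfColour c v j ≡ sum (edge v)
    sum-neighboursOfColour c v = begin
      ∑[ j < k ] ∑[ w < n ] (edge v w * iverson (c w ≟ j))
        ≡⟨ ∑-comm (λ j w → edge v w * iverson (c w ≟ j)) ⟩
      ∑[ w < n ] ∑[ j < k ] (edge v w * iverson (c w ≟ j))
        ≡⟨ sum-cong-≗ (λ w → *-distribˡ-sum (edge v w) (iverson ∘ (c w ≟_))) ⟨
      ∑[ w < n ] (edge v w * ∑[ j < k ] iverson (c w ≟ j))
        ≡⟨ sum-cong-≗ (λ w → cong (edge v w *_) (sum-iverson-≟ (c w))) ⟩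
      ∑[ w < n ] (edge v w * 1)
        ≡⟨ sum-cong-≗ (λ w → *-identityʳ (edge v w)) ⟩
      sum (edge v)
        ∎
      where open ≡-Reasoning

    rareColour : ∀ c v → degree G v < 2 * k → ∃[ j ] neighboursOfColour c v j ≤ 1
    rareColour c v deg<2k with all? (λ j → 2 ≤? neighboursOfColour c v j)
    ... | yes often = contradiction (*-≤-sum 2 (neighboursOfColour c v) often) (<⇒≱ k*2>deg)
      where
      k*2>deg : ∑[ j < k ] neighboursOfColour c v j < k * 2
      k*2>deg = subst₂ _<_ (trans (degree≡sum-edge v) (sym (sum-neighboursOfColour c v))) (*-comm 2 k) deg<2k
    ... | no ¬often with ¬∀⟶∃¬ k _ (λ j → 2 ≤? neighboursOfColour c v j) ¬often
    ... | j , ¬2≤ = j , ≤-pred (≰⇒> ¬2≤)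

    defect-recolour : ∀ c x j → defect (recolour c x j) x ≡ neighboursOfColour c x j
    defect-recolour c x j = sum-cong-≗ same
      where
      same : ∀ w → monochromatic (recolour c x j) x w ≡ edge x w * iverson (c w ≟ j)
      same w with w ≟ x
      ... | yes refl rewrite edge-irrefl w = refl
      ... | no w≢x =
        cong₂ (λ a b → edge x w * iverson (a ≟ b)) (updateAt-minimal w x c w≢x) (updateAt-updates x c)

    totalDefect-recolour : ∀ c x j →
      totalDefect c + neighboursOfColour c x j + neighboursOfColour c x j ≡
      totalDefect (recolour c x j) + defect c x + defect c x
    totalDefect-recolour c x j =
      subst (λ N → totalDefect c + N + N ≡ totalDefect c′ + defect c x + defect c x) (defect-recolour c x j)
        (sum²-update (monochromatic c) (monochromatic c′) x
          (λ v → monochromatic-sym c v x) (λ v → monochromatic-sym c′ v x)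
          (monochromatic-irrefl c x) (monochromatic-irrefl c′ x) agree)
      where
      c′ : Colouring k
      c′ = recolour c x j
      agree : ∀ v w → v ≢ x → w ≢ x → monochromatic c v w ≡ monochromatic c′ v w
      agree v w v≢x w≢x =
        cong₂ (λ a b → edge v w * iverson (a ≟ b))
              (sym (updateAt-minimal w x c w≢x)) (sym (updateAt-minimal v x c v≢x))

    recolour-reducesDefect : ∀ c x j → 2 ≤ defect c x → neighboursOfColour c x j ≤ 1 →
                             totalDefect (recolour c x j) < totalDefect c
    recolour-reducesDefect c x j 2≤defect rare =
      <-≤-trans (m<m+n T′ (s≤s z≤n)) (+-cancelʳ-≤ 2 (T′ + 2) T T′+4≤T+2)
      where
      T T′ a b : ℕ
      T = totalDefect c
      T′ = totalDefect (recolour c x j)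
      a = defect c x
      b = neighboursOfColour c x j
      T′+4≤T+2 : T′ + 2 + 2 ≤ T + 2
      T′+4≤T+2 = begin
        T′ + 2 + 2  ≤⟨ +-mono-≤ (+-monoʳ-≤ T′ 2≤defect) 2≤defect ⟩
        T′ + a + a  ≡⟨ totalDefect-recolour c x j ⟨
        T + b + b   ≤⟨ +-mono-≤ (+-monoʳ-≤ T rare) rare ⟩
        T + 1 + 1   ≡⟨ +-assoc T 1 1 ⟩
        T + 2       ∎
        where open ≤-Reasoning

    defectiveColouring : Fin k → (∀ v → degree G v < 2 * k) → Σ (Colouring k) OneDefective
    defectiveColouring j₀ deg<2k = improve (const j₀) (<-wellFounded _)
      where
      improve : ∀ c → Acc _<_ (totalDefect c) → Σ (Colouring k) OneDefective
      improve c (acc smaller) with all? (λ v → defect c v ≤? 1)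
      ... | yes oneDefective = c , oneDefective
      ... | no ¬oneDefective with ¬∀⟶∃¬ n _ (λ v → defect c v ≤? 1) ¬oneDefective
      ... | x , defect≰1 with rareColour c x (deg<2k x)
      ... | j , rare = improve (recolour c x j) (smaller (recolour-reducesDefect c x j (≰⇒> defect≰1) rare))

module MatchingLabel {n} {_~_ : Fin n → Fin n → Set} (_~?_ : Decidable _~_)
  (~-sym : ∀ {v w} → v ~ w → w ~ v) (~-irrefl : ∀ {v} → ¬ v ~ v)
  (~-functional : ∀ {v w w′} → v ~ w → v ~ w′ → w ≡ w′) where

  LowerMate : Fin n → Set
  LowerMate v = ∃[ w ] (v ~ w × w Fin.< v)

  lowerMate? : ∀ v → Dec (LowerMate v)
  lowerMate? v = any? (λ w → (v ~? w) ×-dec (w FinP.<? v))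

  labelFrom : ∀ v → Dec (LowerMate v) → ℕ
  labelFrom v (yes (w , _)) = suc (2 * toℕ w)
  labelFrom v (no _)        = 2 * toℕ v

  label : Fin n → ℕ
  label v = labelFrom v (lowerMate? v)

  label-upper : ∀ {u v} → u ~ v → u Fin.< v → label v ≡ suc (2 * toℕ u)
  label-upper {u} {v} u~v u<v with lowerMate? v
  ... | yes (w , v~w , _) = cong (λ z → suc (2 * toℕ z)) (~-functional v~w (~-sym u~v))
  ... | no ¬lower = contradiction (u , ~-sym u~v , u<v) ¬lower

  label-lower : ∀ {u v} → u ~ v → u Fin.< v → label u ≡ 2 * toℕ u
  label-lower {u} {v} u~v u<v with lowerMate? u
  ... | yes (w , u~w , w<u) = contradiction (subst (Fin._< u) (~-functional u~w u~v) w<u) (FinP.<-asym u<v)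
  ... | no _ = refl

  label-consecutive : ∀ {u v} → u ~ v → label v ≡ suc (label u) ⊎ label u ≡ suc (label v)
  label-consecutive {u} {v} u~v with FinP.<-cmp u v
  ... | tri< u<v _ _ = inj₁ (trans (label-upper u~v u<v) (cong suc (sym (label-lower u~v u<v))))
  ... | tri> _ _ v<u = inj₂ (trans (label-upper (~-sym u~v) v<u) (cong suc (sym (label-lower (~-sym u~v) v<u))))
  ... | tri≈ _ refl _ = contradiction u~v ~-irrefl

  label-injective : ∀ u v → label u ≡ label v → u ≡ v
  label-injective u v = labelFrom-injective (lowerMate? u) (lowerMate? v)
    where
    labelFrom-injective : ∀ du dv → labelFrom u du ≡ labelFrom v dv → u ≡ v
    labelFrom-injective (no _) (no _) eq = toℕ-injective (*-cancelˡ-≡ (toℕ u) (toℕ v) 2 eq)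
    labelFrom-injective (no _) (yes (q , _)) eq = contradiction eq (even≢odd (toℕ u) (toℕ q))
    labelFrom-injective (yes (p , _)) (no _) eq = contradiction (sym eq) (even≢odd (toℕ v) (toℕ p))
    labelFrom-injective (yes (p , u~p , _)) (yes (q , v~q , _)) eq
      with toℕ-injective (*-cancelˡ-≡ (toℕ p) (toℕ q) 2 (suc-injective eq))
    ... | refl = ~-functional (~-sym u~p) (~-sym v~q)

CoordinateStep : ∀ {m} → Point m → Point m → Set
CoordinateStep a b = ∃[ i ] ∣ lookup b i - lookup a i ∣ ≡ 1

≡-fromLookup : ∀ {A : Set} {m} (xs ys : Vec A m) → (∀ i → lookup xs i ≡ lookup ys i) → xs ≡ ys
≡-fromLookup xs ys eq = trans (sym (tabulate∘lookup xs)) (trans (tabulate-cong eq) (tabulate∘lookup ys))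

parameter-endpoint : ∀ {s t} k → t * k ≡ s → s ≤ t → s ≡ 0 ⊎ s ≡ t
parameter-endpoint {s} {t} zero    tk≡s _   = inj₁ (trans (sym tk≡s) (*-zeroʳ t))
parameter-endpoint {s} {t} (suc k) tk≡s s≤t = inj₂ (≤-antisym s≤t (subst (t ≤_) tk≡s (m≤m*n t (suc k))))

-- In coordinate i the segment equation reads t·∣pᵢ − aᵢ∣ = s ≤ t, so the parameter s/t is 0 or 1.
coordinateStep⇒segment-endpoints : ∀ {m} {a b p : Point m} →
                                   CoordinateStep a b → OnSegment a b p → p ≡ a ⊎ p ≡ b
coordinateStep⇒segment-endpoints {m} {a} {b} {p} (i , step) (s , suc t , _ , s≤t , scaled)
  with parameter-endpoint ∣ lookup p i - lookup a i ∣ t*∣p-a∣≡s s≤t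
  where
  t*∣p-a∣≡s : suc t * ∣ lookup p i - lookup a i ∣ ≡ s
  t*∣p-a∣≡s = begin
    suc t * ∣ lookup p i - lookup a i ∣       ≡⟨ ℤP.abs-* (ℤ.+ suc t) (lookup p i - lookup a i) ⟨
    ∣ ℤ.+ suc t ℤ.* (lookup p i - lookup a i) ∣ ≡⟨ cong ∣_∣ (scaled i) ⟩
    ∣ ℤ.+ s ℤ.* (lookup b i - lookup a i) ∣     ≡⟨ ℤP.abs-* (ℤ.+ s) (lookup b i - lookup a i) ⟩
    s * ∣ lookup b i - lookup a i ∣           ≡⟨ cong (s *_) step ⟩
    s * 1                                     ≡⟨ *-identityʳ s ⟩
    s                                         ∎
    where open ≡-Reasoning
... | inj₁ refl = inj₁ (≡-fromLookup p a λ f →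
  ℤP.i-j≡0⇒i≡j _ _ ([ (λ ()) , id ]′ (ℤP.i*j≡0⇒i≡0∨j≡0 (ℤ.+ suc t) (scaled f))))
... | inj₂ refl = inj₂ (≡-fromLookup p b λ f →
  ∙-cancelʳ (ℤ.- lookup a f) _ _ (ℤP.*-cancelˡ-≡ (ℤ.+ suc t) _ _ (scaled f)))

coordinateSteps⇒primitiveGridDrawing : ∀ {n m} (G : Graph n) (φ : Fin n → Point m) →
  (∀ u v → φ u ≡ φ v → u ≡ v) → (∀ u v → adj G u v ≡ true → CoordinateStep (φ u) (φ v)) →
  IsPrimitiveGridDrawing G φ
coordinateSteps⇒primitiveGridDrawing G φ φ-injective steps = (φ-injective , noVertexInside) , noPointInside
  where
  noPointInside : ∀ u v p → adj G u v ≡ true → OnSegment (φ u) (φ v) p → p ≡ φ u ⊎ p ≡ φ v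
  noPointInside u v p uv = coordinateStep⇒segment-endpoints (steps u v uv)
  noVertexInside : ∀ u v w → adj G u v ≡ true → OnSegment (φ u) (φ v) (φ w) → w ≡ u ⊎ w ≡ v
  noVertexInside u v w uv onSegment with noPointInside u v (φ w) uv onSegment
  ... | inj₁ φw≡φu = inj₁ (φ-injective w u φw≡φu)
  ... | inj₂ φw≡φv = inj₂ (φ-injective w v φw≡φv)

lookup-∷ʳ-inject₁ : ∀ {A : Set} {m} (xs : Vec A m) x i → lookup (xs ∷ʳ x) (inject₁ i) ≡ lookup xs i
lookup-∷ʳ-inject₁ (y ∷ xs) x zero    = refl
lookup-∷ʳ-inject₁ (y ∷ xs) x (suc i) = lookup-∷ʳ-inject₁ xs x i

lookup-∷ʳ-last : ∀ {A : Set} {m} (xs : Vec A m) x → lookup (xs ∷ʳ x) (fromℕ m) ≡ x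
lookup-∷ʳ-last []       x = refl
lookup-∷ʳ-last (y ∷ xs) x = lookup-∷ʳ-last xs x

coordinateStep-∷ʳ-init : ∀ {m} (xs ys : Vec ℤ m) {x y} →
                         CoordinateStep xs ys → CoordinateStep (xs ∷ʳ x) (ys ∷ʳ y)
coordinateStep-∷ʳ-init xs ys {x} {y} (i , step) =
  inject₁ i , trans (cong₂ (λ a b → ∣ a - b ∣) (lookup-∷ʳ-inject₁ ys y i) (lookup-∷ʳ-inject₁ xs x i)) step

coordinateStep-∷ʳ-last : ∀ {m} (xs ys : Vec ℤ m) {x y} → ∣ y - x ∣ ≡ 1 → CoordinateStep (xs ∷ʳ x) (ys ∷ʳ y)
coordinateStep-∷ʳ-last {m} xs ys {x} {y} step =
  fromℕ m , trans (cong₂ (λ a b → ∣ a - b ∣) (lookup-∷ʳ-last ys y) (lookup-∷ʳ-last xs x)) step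

∣[1+h]-h∣≡1 : ∀ h → ∣ ℤ.+ suc h - ℤ.+ h ∣ ≡ 1
∣[1+h]-h∣≡1 h = begin
  ∣ ℤ.+ suc h - ℤ.+ h ∣   ≡⟨ cong ∣_∣ (ℤP.m-n≡m⊖n (suc h) h) ⟩
  ∣ suc h ℤ.⊖ h ∣        ≡⟨ cong ∣_∣ (ℤP.⊖-≥ (n≤1+n h)) ⟩
  suc h ∸ h              ≡⟨ m+n∸n≡m 1 h ⟩
  1                      ∎
  where open ≡-Reasoning

binaryDigits : ∀ d → Fin (2 ^ d) → Vec ℤ d
binaryDigits zero    _ = []
binaryDigits (suc d) i = ℤ.+ toℕ (quotient {2} (2 ^ d) i) ∷ binaryDigits d (remainder {2} (2 ^ d) i)

binaryDigits-separated : ∀ d {i j} → i ≢ j → CoordinateStep (binaryDigits d i) (binaryDigits d j)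
binaryDigits-separated zero {zero} {zero} i≢j = contradiction refl i≢j
binaryDigits-separated (suc d) {i} {j} i≢j with quotient {2} (2 ^ d) i ≟ quotient (2 ^ d) j
... | no q≢q′ = zero , bitStep q≢q′
  where
  bitStep : ∀ {a b : Fin 2} → a ≢ b → ∣ ℤ.+ toℕ b - ℤ.+ toℕ a ∣ ≡ 1
  bitStep {zero}     {zero}     a≢b = contradiction refl a≢b
  bitStep {zero}     {suc zero} _   = refl
  bitStep {suc zero} {zero}     _   = refl
  bitStep {suc zero} {suc zero} a≢b = contradiction refl a≢b
... | yes q≡q′ with binaryDigits-separated d (i≢j ∘ digits-determine q≡q′)
  where
  digits-determine : quotient {2} (2 ^ d) i ≡ quotient (2 ^ d) j →
                     remainder {2} (2 ^ d) i ≡ remainder (2 ^ d) j → i ≡ j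
  digits-determine q≡q′ r≡r′ = begin
    i                                       ≡⟨ combine-remQuot {2} (2 ^ d) i ⟨
    uncurry combine (remQuot {2} (2 ^ d) i) ≡⟨ cong₂ combine q≡q′ r≡r′ ⟩
    uncurry combine (remQuot {2} (2 ^ d) j) ≡⟨ combine-remQuot {2} (2 ^ d) j ⟩
    j                                       ∎
    where open ≡-Reasoning
... | f , step = suc f , step

binaryDigits-injective : ∀ d i j → binaryDigits d i ≡ binaryDigits d j → i ≡ j
binaryDigits-injective d i j eq with i ≟ j
... | yes i≡j = i≡j
... | no i≢j with binaryDigits-separated d i≢j
... | f , step =
  contradiction (trans (sym step) (cong ∣_∣ (difference-zero (cong (λ xs → lookup xs f) (sym eq))))) λ ()
  where
  difference-zero : ∀ {a b} → b ≡ a → b - a ≡ ℤ.+ 0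
  difference-zero {a} refl = ℤP.+-inverseʳ a

module _ {n} (G : Graph n) (d : ℕ) (c : Colouring G (2 ^ d)) (oneDefective : OneDefective G c) where

  SameColourEdge : Fin n → Fin n → Set
  SameColourEdge v w = adj G v w ≡ true × c v ≡ c w

  sameColourEdge? : Decidable SameColourEdge
  sameColourEdge? v w = (adj G v w Bool.≟ true) ×-dec (c v ≟ c w)

  sameColourEdge-sym : ∀ {v w} → SameColourEdge v w → SameColourEdge w v
  sameColourEdge-sym {v} {w} (vw , cv≡cw) = trans (Graph.sym G w v) vw , sym cv≡cw

  sameColourEdge-irrefl : ∀ {v} → ¬ SameColourEdge v v
  sameColourEdge-irrefl {v} (vv , _) with trans (sym vv) (Graph.irrefl G v)
  ... | ()

  sameColourEdge-functional : ∀ {v w w′} → SameColourEdge v w → SameColourEdge v w′ → w ≡ w′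
  sameColourEdge-functional {v} {w} {w′} vw vw′ with w ≟ w′
  ... | yes w≡w′ = w≡w′
  ... | no w≢w′ = contradiction (≤-trans 2≤defect (oneDefective v)) λ { (s≤s ()) }
    where
    monochromatic≡1 : ∀ {u} → SameColourEdge v u → monochromatic G c v u ≡ 1
    monochromatic≡1 {u} (vu , cv≡cu) =
      cong₂ _*_ (iverson-yes (adj G v u Bool.≟ true) vu) (iverson-yes (c u ≟ c v) (sym cv≡cu))
    2≤defect : 2 ≤ defect G c v
    2≤defect = subst (_≤ defect G c v) (cong₂ _+_ (monochromatic≡1 vw) (monochromatic≡1 vw′))
                     (+-≤-sum (monochromatic G c v) w≢w′)

  open MatchingLabel sameColourEdge? sameColourEdge-sym sameColourEdge-irrefl sameColourEdge-functional

  digits : Fin n → Vec ℤ d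
  digits v = binaryDigits d (c v)

  position : Fin n → Point (suc d)
  position v = digits v ∷ʳ ℤ.+ label v

  position-injective : ∀ u v → position u ≡ position v → u ≡ v
  position-injective u v eq = label-injective u v (ℤP.+-injective (∷ʳ-injectiveʳ _ _ eq))

  position-coordinateStep : ∀ u v → adj G u v ≡ true → CoordinateStep (position u) (position v)
  position-coordinateStep u v uv with c u ≟ c v
  ... | no cu≢cv = coordinateStep-∷ʳ-init (digits u) (digits v) (binaryDigits-separated d cu≢cv)
  ... | yes cu≡cv = coordinateStep-∷ʳ-last (digits u) (digits v) (labelStep (label-consecutive (uv , cu≡cv)))
    where
    labelStep : label v ≡ suc (label u) ⊎ label u ≡ suc (label v) → ∣ ℤ.+ label v - ℤ.+ label u ∣ ≡ 1
    labelStep (inj₁ up)   rewrite up = ∣[1+h]-h∣≡1 (label u)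
    labelStep (inj₂ down) rewrite down =
      trans (ℤP.∣i-j∣≡∣j-i∣ (ℤ.+ label v) (ℤ.+ suc (label v))) (∣[1+h]-h∣≡1 (label v))

  oneDefective⇒locatedOnColumns : LocatedOnColumns G (2 ^ d) d
  oneDefective⇒locatedOnColumns =
    position ,
    coordinateSteps⇒primitiveGridDrawing G position position-injective position-coordinateStep ,
    binaryDigits d , binaryDigits-injective d ,
    λ v → c v , init-∷ʳ (ℤ.+ label v) (digits v)

mainTheorem10 : (d : ℕ) → 1 ≤ d → (n : ℕ) → (G : Graph n) →
    (∀ v → degree G v ≤ (2 ^ (d + 1)) ∸ 1) →
    LocatedOnColumns G (2 ^ d) d
mainTheorem10 d _ n G degree≤ with defectiveColouring G (fromℕ< (m^n>0 2 d)) degree<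
  where
  degree< : ∀ v → degree G v < 2 * 2 ^ d
  degree< v = subst (degree G v <_) (cong (2 ^_) (+-comm d 1))
                    (m≤pred[n]⇒suc[m]≤n {{m^n≢0 2 (d + 1)}} (degree≤ v))
... | c , oneDefective = oneDefective⇒locatedOnColumns G d c oneDefective
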